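{- Let $\Gamma$ be a connected bipartite distance-balanced graph that is not a cycle and is not $3$-connected. Let $\{a,b\}\subseteq V(\Gamma)$ be a $2$-cut of $\Gamma$ such that $d(a,b)$ is minimal among all $2$-cuts of $\Gamma$, and let $\Gamma_1,\Gamma_2$ be the two connected components of $\Gamma-\{a,b\}$. Then for every $x\in V(\Gamma_1)$ and $y\in V(\Gamma_2)$ we have $$d(x,y)=\min\{d(x,a)+d(a,y),\ d(x,b)+d(b,y)\}.$$
   Context: All graphs are finite, simple, undirected. $d(u,v)$ denotes the distance in $\Gamma$. For $u,v\in V(\Gamma)$ let $W_{uv}=\{z\in V(\Gamma): d(u,z)<d(v,z)\}$. A connected graph is distance-balanced if $|W_{uv}|=|W_{vu}|$ for every pair of adjacent vertices $u,v$. A $k$-cut is a set of $k$ vertices whose removal disconnects the graph; a graph is $k$-connected if it has at least $k+1$ vertices and every vertex cut has at least $k$ vertices. It is known that a distance-balanced graph with at least two edges is $2$-connected, and that for $\Gamma,a,b$ as in the claim, $d(a,b)\ge 2$ and $\Gamma-\{a,b\}$ has exactly two connected components. -}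

module Defs where

open import Data.Nat using (ℕ; zero; suc; _+_; _≤_; _<ᵇ_; _≡ᵇ_; _⊓_)
open import Data.Nat.DivMod using (_%_)
open import Data.Bool using (Bool; true; false; _∧_; _∨_; not; if_then_else_; T)
open import Data.Fin using (Fin; toℕ; _≟_)
open import Data.List using (List; allFin; filter; length)
open import Data.Bool.ListAction using (any)
open import Data.Product using (Σ; ∃; _×_; _,_)
open import Relation.Nullary using (¬_; does)
open import Relation.Binary.PropositionalEquality using (_≡_; _≢_)
open import Function.Bundles using (_↔_; Inverse; _⇔_)
open import Data.Sum using (_⊎_)

record Graph : Set where
  field
    n     : ℕ
    adj   : Fin n → Fin n → Bool
    sym   : ∀ u v → adj u v ≡ adj v u
    irrefl : ∀ u → adj u u ≡ false
open Graph public

module _ (Γ : Graph) where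
  private
    V = Fin (n Γ)

  _==_ : V → V → Bool
  u == v = does (u ≟ v)

  -- reachIn A k u v : there is a walk of length ≤ k from u to v all of whose
  -- vertices (including u and v) lie in the vertex set A.
  reachIn : (V → Bool) → ℕ → V → V → Bool
  reachIn A zero    u v = A u ∧ (u == v)
  reachIn A (suc k) u v =
    reachIn A k u v ∨ (A u ∧ any (λ w → adj Γ u w ∧ reachIn A k w v) (allFin (n Γ)))

  reach : ℕ → V → V → Bool
  reach = reachIn (λ _ → true)

  search : (ℕ → Bool) → ℕ → ℕ → ℕ
  search f i zero    = i
  search f i (suc m) = if f i then i else search f (suc i) m

  -- distance d(u,v): length of a shortest u–v walk (a shortest walk in a graph
  -- with n vertices has length < n; for unreachable pairs the value n is
  -- returned, which never occurs in connected graphs)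
  dist : V → V → ℕ
  dist u v = search (λ k → reach k u v) 0 (n Γ)

  Connected : Set
  Connected = ∀ u v → ∃ λ k → reach k u v ≡ true

  count : (V → Bool) → ℕ
  count P = length (filter (λ z → T? (P z)) (allFin (n Γ)))
    where
      open import Data.Bool.Properties using () renaming (T? to T?)

  W : V → V → V → Bool
  W u v z = dist u z <ᵇ dist v z

  DistanceBalanced : Set
  DistanceBalanced =
    Connected × (∀ u v → adj Γ u v ≡ true → count (W u v) ≡ count (W v u))

  Bipartite : Set
  Bipartite = Σ (V → Bool) λ c → ∀ u v → adj Γ u v ≡ true → c u ≢ c v

  -- S (a set of vertices) is a vertex cut: Γ − S is disconnected, i.e. there
  -- are two vertices outside S joined by no walk avoiding S.
  IsCut : (V → Bool) → Set
  IsCut S = Σ V λ x → Σ V λ y → S x ≡ false × S y ≡ false ×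
            (∀ k → reachIn (λ z → not (S z)) k x y ≡ false)

  KConnected : ℕ → Set
  KConnected k = suc k ≤ n Γ × (∀ S → IsCut S → k ≤ count S)

  pair : V → V → V → Bool
  pair a b z = (z == a) ∨ (z == b)

  Is2Cut : V → V → Set
  Is2Cut a b = a ≢ b × IsCut (pair a b)

  DifferentComponents : V → V → V → V → Set
  DifferentComponents a b x y =
    pair a b x ≡ false × pair a b y ≡ false ×
    (∀ k → reachIn (λ z → not (pair a b z)) k x y ≡ false)

nextMod : ℕ → ℕ → ℕ
nextMod m i = if suc i ≡ᵇ m then 0 else suc i

cycleAdj : (m : ℕ) → Fin m → Fin m → Set
cycleAdj m i j = (toℕ j ≡ nextMod m (toℕ i)) ⊎ (toℕ i ≡ nextMod m (toℕ j))

IsCycle : Graph → Set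
IsCycle Γ = 3 ≤ n Γ × Σ (Fin (n Γ) ↔ Fin (n Γ)) λ f →
  ∀ i j → (adj Γ (Inverse.to f i) (Inverse.to f j) ≡ true) ⇔ cycleAdj (n Γ) i j

module Submission where

-- Only two hypotheses of the theorem carry weight: Γ is
-- connected, and x, y lie in different components of Γ − {a,b}.  The
-- equality then holds for every separating set: a shortest x–y walk must
-- meet the separator in some vertex z, splitting into an x–z and a z–y
-- walk, so d(x,y) ≥ d(x,z) + d(z,y); the triangle inequality gives ≤.

open import Defs hiding (sym)
open import Data.Nat using (ℕ; zero; suc; _+_; _∸_; _⊓_; _≤_; _<_; _≤?_; s≤s; z≤n)
open import Data.Nat.Properties
  using (≤-trans; ≤-antisym; ≤-pred; ≤∧≢⇒<; m≤n⇒m≤1+n; m+[n∸m]≡n;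
         +-monoˡ-<; +-mono-≤; +-suc; +-identityʳ; <⇒≱; ≰⇒>; ⊓-glb; m⊓n≤m; m⊓n≤n)
open import Data.Nat.Induction using (<-rec)
open import Data.Fin using (Fin; toℕ; _≟_) renaming (zero to fzero; suc to fsuc)
open import Data.Fin.Properties using (pigeonhole; toℕ<n)
open import Data.Bool using (Bool; true; false; T; not)
open import Data.Bool.Properties using (T-∧; T-∨)
open import Data.List using (allFin)
open import Data.List.Relation.Unary.Any using (satisfied)
open import Data.List.Relation.Unary.Any.Properties using (any⁺; any⁻)
open import Data.List.Membership.Propositional using (lose)
open import Data.List.Membership.Propositional.Properties using (∈-allFin)
open import Data.Product using (Σ; ∃; _×_; _,_)
open import Data.Sum using (_⊎_; inj₁; inj₂)
open import Data.Empty using (⊥-elim)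
open import Function using (_∘_)
open import Function.Bundles using (Equivalence)
open import Relation.Nullary using (¬_; yes; no)
open import Relation.Binary.PropositionalEquality
  using (_≡_; _≢_; refl; sym; cong; subst)

module Paths (Γ : Graph) where

  V : Set
  V = Fin (n Γ)

  data Walk (A : V → Bool) : ℕ → V → V → Set where
    nil  : ∀ {u} → T (A u) → Walk A 0 u u
    cons : ∀ {k u w v} → T (A u) → T (adj Γ u w) → Walk A k w v →
           Walk A (suc k) u v

  Path : ℕ → V → V → Set
  Path = Walk (λ _ → true)

  append : ∀ {A i j u w v} → Walk A i u w → Walk A j w v → Walk A (i + j) u v
  append (nil _)        q = q
  append (cons Au e p)  q = cons Au e (append p q)

  ==-sound : ∀ {u v : V} → T (_==_ Γ u v) → u ≡ v
  ==-sound {u} {v} t with u ≟ v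
  ... | yes u≡v = u≡v

  ==-refl : ∀ (u : V) → T (_==_ Γ u u)
  ==-refl u with u ≟ u
  ... | yes _   = _
  ... | no u≢u  = u≢u refl

  reachIn-sound : ∀ A k {u v} → T (reachIn Γ A k u v) →
                  ∃ λ j → j ≤ k × Walk A j u v
  reachIn-sound A zero {u} {v} r with Equivalence.to T-∧ r
  ... | Au , u==v with ==-sound {u} {v} u==v
  ... | refl = 0 , z≤n , nil Au
  reachIn-sound A (suc k) r with Equivalence.to T-∨ r
  ... | inj₁ r′ with reachIn-sound A k r′
  ...   | j , j≤k , p = j , m≤n⇒m≤1+n j≤k , p
  reachIn-sound A (suc k) r | inj₂ step with Equivalence.to T-∧ step
  ... | Au , some with satisfied (any⁻ _ (allFin (n Γ)) some)
  ...   | w , edge-then-reach with Equivalence.to T-∧ edge-then-reach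
  ...     | e , r′ with reachIn-sound A k r′
  ...       | j , j≤k , p = suc j , s≤s j≤k , cons Au e p

  reachIn-complete : ∀ {A k u v} → Walk A k u v → T (reachIn Γ A k u v)
  reachIn-complete {u = u} (nil Au) =
    Equivalence.from T-∧ (Au , ==-refl u)
  reachIn-complete (cons {w = w} Au e p) =
    Equivalence.from T-∨ (inj₂ (Equivalence.from T-∧
      (Au , any⁺ _ (lose (∈-allFin w)
                         (Equivalence.from T-∧ (e , reachIn-complete p))))))

  at : ∀ {A k u v} → Walk A k u v → Fin (suc k) → V
  at {u = u} p            fzero    = u
  at         (cons _ _ p) (fsuc i) = at p i

  prefix : ∀ {A k u v} (p : Walk A k u v) (i : Fin (suc k)) →
           Walk A (toℕ i) u (at p i)
  prefix (nil Au)      fzero    = nil Au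
  prefix (cons Au _ _) fzero    = nil Au
  prefix (cons Au e p) (fsuc i) = cons Au e (prefix p i)

  suffix : ∀ {A k u v} (p : Walk A k u v) (i : Fin (suc k)) →
           Walk A (k ∸ toℕ i) (at p i) v
  suffix p            fzero    = p
  suffix (cons _ _ p) (fsuc i) = suffix p i

  -- A walk with at least n edges visits n+1 > n vertex positions, so two
  -- coincide; removing the closed walk between them shortens it.
  cut-repetition : ∀ {A k u v} → Walk A k u v → n Γ ≤ k →
                   ∃ λ j → j < k × Walk A j u v
  cut-repetition {A} {k} {v = v} p n≤k
    with i , j , i<j , same ← pigeonhole (s≤s n≤k) (at p) =
    toℕ i + (k ∸ toℕ j) , shorter ,
    append (prefix p i) (subst (λ z → Walk A (k ∸ toℕ j) z v) (sym same) (suffix p j))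
    where
      shorter : toℕ i + (k ∸ toℕ j) < k
      shorter = subst (toℕ i + (k ∸ toℕ j) <_) (m+[n∸m]≡n (≤-pred (toℕ<n j)))
                      (+-monoˡ-< (k ∸ toℕ j) i<j)

  short-walk : ∀ {A k u v} → Walk A k u v → ∃ λ j → j < n Γ × Walk A j u v
  short-walk {A} {k} {u} {v} = <-rec Motive shorten k
    where
      Motive : ℕ → Set
      Motive k = Walk A k u v → ∃ λ j → j < n Γ × Walk A j u v

      shorten : ∀ k → (∀ {j} → j < k → Motive j) → Motive k
      shorten k rec p with n Γ ≤? k
      ... | no  n≰k = k , ≰⇒> n≰k , p
      ... | yes n≤k with j , j<k , q ← cut-repetition p n≤k = rec j<k q

  step-past : ∀ (f : ℕ → Bool) {i j} → f i ≡ false → T (f j) → i ≤ j → suc i ≤ j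
  step-past f fi fj i≤j = ≤∧≢⇒< i≤j i≢j
    where
      i≢j : _ ≢ _
      i≢j refl = subst T fi fj

  search-least : ∀ (f : ℕ → Bool) i m {j} → T (f j) → i ≤ j → search Γ f i m ≤ j
  search-least f i zero    fj i≤j = i≤j
  search-least f i (suc m) fj i≤j with f i in fi
  ... | true  = i≤j
  ... | false = search-least f (suc i) m fj (step-past f fi fj i≤j)

  search-hit : ∀ (f : ℕ → Bool) i m {j} → T (f j) → i ≤ j → j < i + m →
               T (f (search Γ f i m))
  search-hit f i zero    fj i≤j j<i = ⊥-elim (<⇒≱ (subst (_ <_) (+-identityʳ i) j<i) i≤j)
  search-hit f i (suc m) {j} fj i≤j j<i+m with f i in fi
  ... | true  = subst T (sym fi) _
  ... | false = search-hit f (suc i) m fj (step-past f fi fj i≤j)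
                            (subst (j <_) (+-suc i m) j<i+m)

  dist-≤-length : ∀ {k u v} → Path k u v → dist Γ u v ≤ k
  dist-≤-length p = search-least _ 0 (n Γ) (reachIn-complete p) z≤n

  -- ... and in a connected graph it is attained: a shortest walk has fewer
  -- than n edges, so the search over lengths 0 … n−1 succeeds.
  dist-attained : Connected Γ → ∀ u v → ∃ λ l → l ≤ dist Γ u v × Path l u v
  dist-attained connected u v
    with k , reach-k ← connected u v
    with j , _ , p ← reachIn-sound _ k (subst T (sym reach-k) _)
    with j′ , j′<n , q ← short-walk p =
    reachIn-sound _ _ (search-hit _ 0 (n Γ) (reachIn-complete q) z≤n j′<n)

  -- (4) Triangle inequality: concatenate shortest walks through c.
  triangle : Connected Γ → ∀ x c y → dist Γ x y ≤ dist Γ x c + dist Γ c y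
  triangle connected x c y
    with l₁ , l₁≤ , p ← dist-attained connected x c
    with l₂ , l₂≤ , q ← dist-attained connected c y =
    ≤-trans (dist-≤-length (append p q)) (+-mono-≤ l₁≤ l₂≤)

  Meets : (V → Bool) → ℕ → V → V → Set
  Meets S k x y = Σ V λ z → T (S z) × Σ ℕ λ i → Σ ℕ λ j →
                  i + j ≡ k × Path i x z × Path j z y

  avoid-or-meet : (S : V → Bool) → ∀ {k x y} → Path k x y →
                  Walk (not ∘ S) k x y ⊎ Meets S k x y
  avoid-or-meet S {k} {x} p with S x in Sx
  ... | true = inj₂ (x , subst T (sym Sx) _ , 0 , k , refl , nil _ , p)
  avoid-or-meet S (nil _) | false = inj₁ (nil (subst (T ∘ not) (sym Sx) _))
  avoid-or-meet S (cons _ e p) | false with avoid-or-meet S p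
  ... | inj₁ q = inj₁ (cons (subst (T ∘ not) (sym Sx) _) e q)
  ... | inj₂ (z , Sz , i , j , i+j≡k , q , r) =
    inj₂ (z , Sz , suc i , j , cong suc i+j≡k , cons _ e q , r)

  separator : Connected Γ → (S : V → Bool) → ∀ {x y} →
              (∀ k → reachIn Γ (not ∘ S) k x y ≡ false) →
              Σ V λ z → T (S z) × dist Γ x z + dist Γ z y ≤ dist Γ x y
  separator connected S {x} {y} separated
    with l , l≤d , p ← dist-attained connected x y
    with avoid-or-meet S p
  ... | inj₁ q = ⊥-elim (subst T (separated l) (reachIn-complete q))
  ... | inj₂ (z , Sz , i , j , refl , q , r) =
    z , Sz , ≤-trans (+-mono-≤ (dist-≤-length q) (dist-≤-length r)) l≤d

  pair-member : ∀ {a b z} → T (pair Γ a b z) → z ≡ a ⊎ z ≡ b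
  pair-member {a} {b} {z} z∈ab with Equivalence.to T-∨ z∈ab
  ... | inj₁ z==a = inj₁ (==-sound {z} {a} z==a)
  ... | inj₂ z==b = inj₂ (==-sound {z} {b} z==b)

-- The theorem: by the triangle inequality d(x,y) is at most either route,
-- and by the separator lemma applied to {a,b} it is at least one of them.
lemma2p1 : (Γ : Graph) → Connected Γ → Bipartite Γ → DistanceBalanced Γ →
    ¬ IsCycle Γ → ¬ KConnected Γ 3 →
    (a b : Fin (n Γ)) → Is2Cut Γ a b →
    (∀ a′ b′ → Is2Cut Γ a′ b′ → dist Γ a b ≤ dist Γ a′ b′) →
    (x y : Fin (n Γ)) → DifferentComponents Γ a b x y →
    dist Γ x y ≡ (dist Γ x a + dist Γ a y) ⊓ (dist Γ x b + dist Γ b y)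
lemma2p1 Γ connected _ _ _ _ a b _ _ x y (_ , _ , separated) =
  ≤-antisym (⊓-glb (triangle connected x a y) (triangle connected x b y))
            through-cut
  where
    open Paths Γ

    through-cut : (dist Γ x a + dist Γ a y) ⊓ (dist Γ x b + dist Γ b y) ≤ dist Γ x y
    through-cut with z , z∈ab , via-z ← separator connected (pair Γ a b) separated
                with pair-member {a} {b} {z} z∈ab
    ... | inj₁ refl = ≤-trans (m⊓n≤m _ _) via-z
    ... | inj₂ refl = ≤-trans (m⊓n≤n _ _) via-z
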